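{- Let $G=(V,E,w)$ be a directed graph with positive integer vertex weights, and let $G'=(V',E',w')$ be the undirected graph with $V'=V_{\mathrm{out}}\cup V_{\mathrm{in}}$ (two disjoint copies $\{v_{\mathrm{out}}:v\in V\}$ and $\{v_{\mathrm{in}}:v\in V\}$ of $V$), whose edges are a clique on $V_{\mathrm{out}}$, a clique on $V_{\mathrm{in}}$, the edges $\{v_{\mathrm{out}},v_{\mathrm{in}}\}$ for $v\in V$, and the edges $\{u_{\mathrm{out}},v_{\mathrm{in}}\}$ for $(u,v)\in E$, with weights $w'(v_{\mathrm{out}})=w'(v_{\mathrm{in}})=w(v)$. Let $s,t\in V$ with $s\neq t$ and $(s,t)\notin E$. Then $\kappa_G(s,t)=\kappa_{G'}(s_{\mathrm{out}},t_{\mathrm{in}})-w(V)$.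
   Context: A vertex cut of a directed graph is a tripartition $(L,S,R)$ of the vertex set with $L,R$ nonempty and no edge $(u,v)$ with $u\in L$, $v\in R$; for an undirected graph, no edge between $L$ and $R$. Its weight is $w(S)=\sum_{v\in S}w(v)$. For vertices $s,t$ of a graph $H$, $\kappa_H(s,t)$ is the minimum weight of a vertex cut $(L,S,R)$ of $H$ with $s\in L$ and $t\in R$. $w(V)=\sum_{v\in V}w(v)$. -}

module Defs where

open import Data.Nat using (ℕ; _≤_)
open import Data.Bool using (Bool; true)
open import Data.Fin using (Fin)
open import Data.List using (List; map; _++_; allFin)
open import Data.Nat.ListAction using (sum)
open import Data.Sum using (_⊎_; inj₁; inj₂; [_,_])
open import Data.Product using (Σ; ∃; _×_)
open import Data.Empty using (⊥)
open import Relation.Binary.PropositionalEquality using (_≡_; _≢_)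

-- Sides of a tripartition (L, S, R) of the vertex set.
data Side : Set where
  L S R : Side

sw : Side → ℕ → ℕ
sw L _ = 0
sw S x = x
sw R _ = 0

-- w(S) for a tripartition f, given a list enumerating all vertices exactly once
weightS : {V : Set} → List V → (V → ℕ) → (V → Side) → ℕ
weightS vs w f = sum (map (λ v → sw (f v) (w v)) vs)

IsDirCut : {V : Set} → (V → V → Set) → (V → Side) → Set
IsDirCut {V} E f =
  (∃ λ u → f u ≡ L) × (∃ λ v → f v ≡ R) ×
  ((u v : V) → E u v → f u ≡ L → f v ≡ R → ⊥)

-- undirected vertex cut: no edge between L and R (Adj is the edge relation,
-- read as unordered, so we forbid both orientations)
IsUndirCut : {V : Set} → (V → V → Set) → (V → Side) → Set
IsUndirCut Adj f = IsDirCut (λ u v → Adj u v ⊎ Adj v u) f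

IsKappa : {V : Set} → ((V → Side) → Set) → List V → (V → ℕ) → V → V → ℕ → Set
IsKappa {V} IsCut vs w s t k =
  (Σ (V → Side) λ f → IsCut f × f s ≡ L × f t ≡ R × weightS vs w f ≡ k) ×
  ((f : V → Side) → IsCut f → f s ≡ L → f t ≡ R → k ≤ weightS vs w f)

Arc : {n : ℕ} → (Fin n → Fin n → Bool) → Fin n → Fin n → Set
Arc E u v = E u v ≡ true

-- The undirected graph G' on V_out ∪ V_in, V_out = inj₁, V_in = inj₂.
data EdgeG' {n : ℕ} (E : Fin n → Fin n → Bool) : Fin n ⊎ Fin n → Fin n ⊎ Fin n → Set where
  out-clique : (u v : Fin n) → u ≢ v → EdgeG' E (inj₁ u) (inj₁ v)
  in-clique  : (u v : Fin n) → u ≢ v → EdgeG' E (inj₂ u) (inj₂ v)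
  out-in     : (v : Fin n) → EdgeG' E (inj₁ v) (inj₂ v)
  arc        : (u v : Fin n) → E u v ≡ true → EdgeG' E (inj₁ u) (inj₂ v)

allV' : (n : ℕ) → List (Fin n ⊎ Fin n)
allV' n = map inj₁ (allFin n) ++ map inj₂ (allFin n)

w' : {n : ℕ} → (Fin n → ℕ) → Fin n ⊎ Fin n → ℕ
w' w = [ w , w ]

totalW : {n : ℕ} → (Fin n → ℕ) → ℕ
totalW {n} w = sum (map w (allFin n))

{-# OPTIONS --safe #-}

-- A minimum s–t cut (L, S, R) of G lifts to the cut of G' with L' = L_out, R' = R_in and all other
-- copies in S'; every vertex of S has both copies in S' and every other vertex exactly one, so the
-- lift weighs w(S) + w(V). Conversely, in an s_out–t_in cut of G' the two cliques keep every
-- out-copy out of R' and every in-copy out of L', and the edge v_out v_in forbids v_out ∈ L' with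
-- v_in ∈ R'; hence each vertex has a copy in S', and putting v into L if v_out ∈ L', into R if
-- v_in ∈ R' and into S otherwise gives an s–t cut of G of weight at most w(S') − w(V).
-- The minimum over cuts of G exists because they can be enumerated.
module Submission where

open import Defs
open import Data.Nat using (ℕ; _<_; _+_; _≤_; zero; suc)
open import Data.Nat.Properties
  using (+-identityʳ; +-mono-≤; +-monoˡ-≤; ≤-refl; ≤-reflexive; +-commutativeSemigroup; module ≤-Reasoning)
open import Data.Nat.ListAction using (sum)
open import Data.Nat.ListAction.Properties using (sum-++)
open import Algebra.Properties.CommutativeSemigroup +-commutativeSemigroup using (interchange)
open import Data.Bool using (Bool; true)
import Data.Bool as Bool
open import Data.Fin using (Fin)
import Data.Fin as Fin
open import Data.Fin.Properties using (all?)
open import Data.Vec.Functional using (Vector; head; tail)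
import Data.Vec.Functional as Vector
open import Data.List using (List; []; _∷_; map; _++_; allFin; filter; cartesianProductWith)
open import Data.List.Properties using (map-++; map-∘; map-cong)
open import Data.List.Membership.Propositional using (_∈_)
open import Data.List.Membership.Propositional.Properties using (∈-filter⁺; ∈-cartesianProductWith⁺)
open import Data.List.Relation.Unary.Any using (here; there)
import Data.List.Relation.Unary.All as All
open import Data.List.Relation.Unary.All.Properties using (all-filter)
open import Data.List.Extrema.Nat using (argmin; argmin-all; f[argmin]≤f[xs])
open import Data.Sum using (_⊎_; inj₁; inj₂; [_,_])
open import Data.Product using (Σ; ∃; _×_; _,_; proj₁; proj₂)
open import Data.Empty using (⊥; ⊥-elim)
open import Function using (_∘_)
open import Relation.Binary.Definitions using (DecidableEquality)
open import Relation.Binary.PropositionalEquality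
  using (_≡_; _≢_; _≗_; refl; sym; trans; cong; cong₂; module ≡-Reasoning)
open import Relation.Nullary using (¬_; yes; no)
open import Relation.Nullary.Decidable using (map′; _×-dec_; _→-dec_; ¬?)
open import Relation.Unary using (Decidable)

module _ {A : Set} where

  sum-map-+ : (f g : A → ℕ) (xs : List A) →
              sum (map (λ x → f x + g x) xs) ≡ sum (map f xs) + sum (map g xs)
  sum-map-+ f g []       = refl
  sum-map-+ f g (x ∷ xs) = trans (cong (f x + g x +_) (sum-map-+ f g xs)) (interchange (f x) (g x) _ _)

  sum-map-mono-≤ : {f g : A → ℕ} → (∀ x → f x ≤ g x) → (xs : List A) →
                   sum (map f xs) ≤ sum (map g xs)
  sum-map-mono-≤ f≤g []       = ≤-refl
  sum-map-mono-≤ f≤g (x ∷ xs) = +-mono-≤ (f≤g x) (sum-map-mono-≤ f≤g xs)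

IsMinimiser : {X : Set} → (X → Set) → (X → ℕ) → X → Set
IsMinimiser P c m = P m × (∀ x → P x → c m ≤ c x)

module _ {X : Set} {_≈_ : X → X → Set} {P : X → Set} (P? : Decidable P) (c : X → ℕ)
         (P-resp : ∀ {x y} → x ≈ y → P x → P y) (c-resp : ∀ {x y} → x ≈ y → c x ≡ c y) where

  minimiser : (xs : List X) → (∀ x → ∃ λ y → y ∈ xs × x ≈ y) →
              ∀ {x₀} → P x₀ → ∃ (IsMinimiser P c)
  minimiser xs covers {x₀} px₀ = m , argmin-all c px₀ (all-filter P? xs) , minimal
    where
    m : X
    m = argmin c x₀ (filter P? xs)

    minimal : ∀ x → P x → c m ≤ c x
    minimal x px with y , y∈xs , x≈y ← covers x = begin
      c m ≤⟨ All.lookup (f[argmin]≤f[xs] x₀ (filter P? xs)) (∈-filter⁺ P? y∈xs (P-resp x≈y px)) ⟩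
      c y ≡⟨ sym (c-resp x≈y) ⟩
      c x ∎
      where open ≤-Reasoning

module _ {A : Set} (as : List A) where

  vectors : (n : ℕ) → List (Vector A n)
  vectors zero    = Vector.[] ∷ []
  vectors (suc n) = cartesianProductWith Vector._∷_ as (vectors n)

  vectors-complete : (∀ a → a ∈ as) → ∀ {n} (f : Vector A n) → ∃ λ g → g ∈ vectors n × f ≗ g
  vectors-complete _           {zero}  f = Vector.[] , here refl , λ ()
  vectors-complete as-complete {suc n} f with g , g∈ , tail-f≗g ← vectors-complete as-complete (tail f) =
    head f Vector.∷ g , ∈-cartesianProductWith⁺ Vector._∷_ (as-complete (head f)) g∈ , λ where
      Fin.zero    → refl
      (Fin.suc i) → tail-f≗g i

_≟_ : DecidableEquality Side
L ≟ L = yes refl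
L ≟ S = no λ ()
L ≟ R = no λ ()
S ≟ L = no λ ()
S ≟ S = yes refl
S ≟ R = no λ ()
R ≟ L = no λ ()
R ≟ S = no λ ()
R ≟ R = yes refl

allSides : List Side
allSides = L ∷ S ∷ R ∷ []

∈-allSides : ∀ a → a ∈ allSides
∈-allSides L = here refl
∈-allSides S = there (here refl)
∈-allSides R = there (there (here refl))

L≢R : L ≢ R
L≢R ()

module _ {V : Set} (vs : List V) (w : V → ℕ) where

  weightS-copies : (F : V ⊎ V → Side) →
                   weightS (map inj₁ vs ++ map inj₂ vs) [ w , w ] F ≡
                   sum (map (λ v → sw (F (inj₁ v)) (w v) + sw (F (inj₂ v)) (w v)) vs)
  weightS-copies F = begin
    sum (map h (map inj₁ vs ++ map inj₂ vs))
      ≡⟨ cong sum (map-++ h (map inj₁ vs) (map inj₂ vs)) ⟩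
    sum (map h (map inj₁ vs) ++ map h (map inj₂ vs))
      ≡⟨ sum-++ (map h (map inj₁ vs)) (map h (map inj₂ vs)) ⟩
    sum (map h (map inj₁ vs)) + sum (map h (map inj₂ vs))
      ≡⟨ sym (cong₂ _+_ (cong sum (map-∘ vs)) (cong sum (map-∘ vs))) ⟩
    sum (map (h ∘ inj₁) vs) + sum (map (h ∘ inj₂) vs)
      ≡⟨ sym (sum-map-+ (h ∘ inj₁) (h ∘ inj₂) vs) ⟩
    sum (map (λ v → h (inj₁ v) + h (inj₂ v)) vs) ∎
    where
    open ≡-Reasoning
    h : V ⊎ V → ℕ
    h x = sw (F x) ([ w , w ] x)

  weightS-cong : {f g : V → Side} → f ≗ g → weightS vs w f ≡ weightS vs w g
  weightS-cong f≗g = cong sum (map-cong (λ v → cong (λ a → sw a (w v)) (f≗g v)) vs)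

  weightS-+-total : (f : V → Side) →
                    weightS vs w f + sum (map w vs) ≡ sum (map (λ v → sw (f v) (w v) + w v) vs)
  weightS-+-total f = sym (sum-map-+ (λ v → sw (f v) (w v)) w vs)

NoArcLR : {V : Set} → (V → V → Set) → (V → Side) → Set
NoArcLR {V} E f = (u v : V) → E u v → f u ≡ L → f v ≡ R → ⊥

IsSTCut : {V : Set} → ((V → Side) → Set) → V → V → (V → Side) → Set
IsSTCut IsCut s t f = IsCut f × f s ≡ L × f t ≡ R

module _ {V : Set} {E : V → V → Set} {s t : V} where

  isSTCut : {f : V → Side} → f s ≡ L → f t ≡ R → NoArcLR E f → IsSTCut (IsDirCut E) s t f
  isSTCut fs ft noArc = ((s , fs) , (t , ft) , noArc) , fs , ft

  isSTCut-resp-≗ : {f g : V → Side} → f ≗ g → IsSTCut (IsDirCut E) s t f → IsSTCut (IsDirCut E) s t g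
  isSTCut-resp-≗ f≗g ((_ , _ , noArc) , fs , ft) =
    isSTCut (trans (sym (f≗g s)) fs) (trans (sym (f≗g t)) ft)
            (λ u v e gu gv → noArc u v e (trans (f≗g u) gu) (trans (f≗g v) gv))

  pointCut : DecidableEquality V → V → Side
  pointCut _≟ᵛ_ v with v ≟ᵛ s | v ≟ᵛ t
  ... | yes _ | _     = L
  ... | no _  | yes _ = R
  ... | no _  | no _  = S

  pointCut-isSTCut : (_≟ᵛ_ : DecidableEquality V) → s ≢ t → ¬ E s t →
                     IsSTCut (IsDirCut E) s t (pointCut _≟ᵛ_)
  pointCut-isSTCut _≟ᵛ_ s≢t ¬st = isSTCut at-s at-t noArc
    where
    at-s : pointCut _≟ᵛ_ s ≡ L
    at-s with s ≟ᵛ s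
    ... | yes _   = refl
    ... | no s≢s = ⊥-elim (s≢s refl)

    at-t : pointCut _≟ᵛ_ t ≡ R
    at-t with t ≟ᵛ s | t ≟ᵛ t
    ... | yes t≡s | _       = ⊥-elim (s≢t (sym t≡s))
    ... | no _    | yes _   = refl
    ... | no _    | no t≢t = ⊥-elim (t≢t refl)

    only-s : ∀ u → pointCut _≟ᵛ_ u ≡ L → u ≡ s
    only-s u _ with u ≟ᵛ s | u ≟ᵛ t
    only-s u _  | yes u≡s | _ = u≡s
    only-s u () | no _    | yes _
    only-s u () | no _    | no _

    only-t : ∀ u → pointCut _≟ᵛ_ u ≡ R → u ≡ t
    only-t u _ with u ≟ᵛ s | u ≟ᵛ t
    only-t u () | yes _ | _
    only-t u _  | no _  | yes u≡t = u≡t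
    only-t u () | no _  | no _

    noArc : NoArcLR E (pointCut _≟ᵛ_)
    noArc u v e u∈L v∈R with refl ← only-s u u∈L | refl ← only-t v v∈R = ¬st e

minimiser⇒IsKappa : {V : Set} {IsCut : (V → Side) → Set} (vs : List V) (w : V → ℕ)
                    {s t : V} {k : ℕ} {f : V → Side} →
                    IsMinimiser (IsSTCut IsCut s t) (weightS vs w) f → weightS vs w f ≡ k →
                    IsKappa IsCut vs w s t k
minimiser⇒IsKappa _ _ {f = f} ((f-cut , fs , ft) , f-min) refl =
  (f , f-cut , fs , ft , refl) , λ g g-cut gs gt → f-min g (g-cut , gs , gt)

module _ {n : ℕ} (E : Fin n → Fin n → Bool) (s t : Fin n) where

  isSTCut? : Decidable (IsSTCut (IsDirCut (Arc E)) s t)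
  isSTCut? f = map′ (λ (fs , ft , noArc) → isSTCut fs ft noArc)
                    (λ ((_ , _ , noArc) , fs , ft) → fs , ft , noArc)
                    (f s ≟ L ×-dec f t ≟ R ×-dec
                     all? λ u → all? λ v → E u v Bool.≟ true →-dec (f u ≟ L →-dec ¬? (f v ≟ R)))

  minimumSTCut : (w : Fin n → ℕ) {f₀ : Fin n → Side} → IsSTCut (IsDirCut (Arc E)) s t f₀ →
                 ∃ (IsMinimiser (IsSTCut (IsDirCut (Arc E)) s t) (weightS (allFin n) w))
  minimumSTCut w = minimiser isSTCut? (weightS (allFin n) w) isSTCut-resp-≗ (weightS-cong (allFin n) w)
                             (vectors allSides n) (vectors-complete allSides ∈-allSides)

outSide : Side → Side
outSide L = L
outSide _ = S

inSide : Side → Side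
inSide R = R
inSide _ = S

liftCut : {V : Set} → (V → Side) → V ⊎ V → Side
liftCut f = [ outSide ∘ f , inSide ∘ f ]

mergeSides : Side → Side → Side
mergeSides L _ = L
mergeSides _ R = R
mergeSides _ _ = S

lowerCut : {V : Set} → (V ⊎ V → Side) → V → Side
lowerCut F v = mergeSides (F (inj₁ v)) (F (inj₂ v))

outSide-L : ∀ a → outSide a ≡ L → a ≡ L
outSide-L L _ = refl

inSide-R : ∀ a → inSide a ≡ R → a ≡ R
inSide-R R _ = refl

outSide≢R : ∀ a → outSide a ≢ R
outSide≢R L ()
outSide≢R S ()
outSide≢R R ()

inSide≢L : ∀ a → inSide a ≢ L
inSide≢L L ()
inSide≢L S ()
inSide≢L R ()

mergeSides-L : ∀ a b → mergeSides a b ≡ L → a ≡ L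
mergeSides-L L _ _ = refl
mergeSides-L S L ()
mergeSides-L S S ()
mergeSides-L S R ()
mergeSides-L R L ()
mergeSides-L R S ()
mergeSides-L R R ()

mergeSides-R : ∀ a b → mergeSides a b ≡ R → b ≡ R
mergeSides-R L _ ()
mergeSides-R S R _ = refl
mergeSides-R R R _ = refl
mergeSides-R S L ()
mergeSides-R S S ()
mergeSides-R R L ()
mergeSides-R R S ()

mergeSides-R⁺ : ∀ a → a ≢ L → mergeSides a R ≡ R
mergeSides-R⁺ L a≢L = ⊥-elim (a≢L refl)
mergeSides-R⁺ S _   = refl
mergeSides-R⁺ R _   = refl

liftSides-weight : ∀ a x → sw (outSide a) x + sw (inSide a) x ≡ sw a x + x
liftSides-weight L x = refl
liftSides-weight S x = refl
liftSides-weight R x = +-identityʳ x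

mergeSides-weight : ∀ a b x → a ≢ R → b ≢ L → (a ≡ L → b ≢ R) →
                    sw (mergeSides a b) x + x ≤ sw a x + sw b x
mergeSides-weight L L _ _   b≢L _   = ⊥-elim (b≢L refl)
mergeSides-weight L S _ _   _   _   = ≤-refl
mergeSides-weight L R _ _   _   ¬LR = ⊥-elim (¬LR refl refl)
mergeSides-weight S L _ _   b≢L _   = ⊥-elim (b≢L refl)
mergeSides-weight S S _ _   _   _   = ≤-refl
mergeSides-weight S R x _   _   _   = ≤-reflexive (sym (+-identityʳ x))
mergeSides-weight R _ _ a≢R _   _   = ⊥-elim (a≢R refl)

liftCut-weight : {V : Set} (vs : List V) (w : V → ℕ) (f : V → Side) →
                 weightS (map inj₁ vs ++ map inj₂ vs) [ w , w ] (liftCut f) ≡ weightS vs w f + sum (map w vs)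
liftCut-weight vs w f = begin
  weightS (map inj₁ vs ++ map inj₂ vs) [ w , w ] (liftCut f)
    ≡⟨ weightS-copies vs w (liftCut f) ⟩
  sum (map (λ v → sw (outSide (f v)) (w v) + sw (inSide (f v)) (w v)) vs)
    ≡⟨ cong sum (map-cong (λ v → liftSides-weight (f v) (w v)) vs) ⟩
  sum (map (λ v → sw (f v) (w v) + w v) vs)
    ≡⟨ sym (weightS-+-total vs w f) ⟩
  weightS vs w f + sum (map w vs) ∎
  where open ≡-Reasoning

module _ {n : ℕ} {E : Fin n → Fin n → Bool} {s t : Fin n} where

  liftCut-isSTCut : {f : Fin n → Side} → IsSTCut (IsDirCut (Arc E)) s t f →
                    IsSTCut (IsUndirCut (EdgeG' E)) (inj₁ s) (inj₂ t) (liftCut f)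
  liftCut-isSTCut {f} ((_ , _ , noArc) , fs , ft) =
    isSTCut {s = inj₁ s} {t = inj₂ t} (cong outSide fs) (cong inSide ft) noEdge
    where
    noEdge : NoArcLR (λ x y → EdgeG' E x y ⊎ EdgeG' E y x) (liftCut f)
    noEdge (inj₂ v) _        _                    v∈L _   = inSide≢L (f v) v∈L
    noEdge _        (inj₁ v) _                    _   v∈R = outSide≢R (f v) v∈R
    noEdge (inj₁ u) (inj₂ v) (inj₁ (out-in _))    u∈L v∈R = L≢R (trans (sym (outSide-L _ u∈L)) (inSide-R _ v∈R))
    noEdge (inj₁ u) (inj₂ v) (inj₁ (arc _ _ e))   u∈L v∈R = noArc u v e (outSide-L _ u∈L) (inSide-R _ v∈R)
    noEdge (inj₁ u) (inj₂ v) (inj₂ ())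

  module _ {F : Fin n ⊎ Fin n → Side} (F-cut : IsSTCut (IsUndirCut (EdgeG' E)) (inj₁ s) (inj₂ t) F) where

    private
      noEdge : NoArcLR (λ x y → EdgeG' E x y ⊎ EdgeG' E y x) F
      noEdge = proj₂ (proj₂ (proj₁ F-cut))

      Fs : F (inj₁ s) ≡ L
      Fs = proj₁ (proj₂ F-cut)

      Ft : F (inj₂ t) ≡ R
      Ft = proj₂ (proj₂ F-cut)

    out≢R : ∀ v → F (inj₁ v) ≢ R
    out≢R v v∈R with v Fin.≟ s
    ... | yes refl = L≢R (trans (sym Fs) v∈R)
    ... | no v≢s   = noEdge (inj₁ s) (inj₁ v) (inj₁ (out-clique s v (v≢s ∘ sym))) Fs v∈R

    in≢L : ∀ v → F (inj₂ v) ≢ L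
    in≢L v v∈L with v Fin.≟ t
    ... | yes refl = L≢R (trans (sym v∈L) Ft)
    ... | no v≢t   = noEdge (inj₂ v) (inj₂ t) (inj₁ (in-clique v t v≢t)) v∈L Ft

    ¬out∈L×in∈R : ∀ v → F (inj₁ v) ≡ L → F (inj₂ v) ≢ R
    ¬out∈L×in∈R v = noEdge (inj₁ v) (inj₂ v) (inj₁ (out-in v))

    lowerCut-isSTCut : IsSTCut (IsDirCut (Arc E)) s t (lowerCut F)
    lowerCut-isSTCut = isSTCut
      (cong (λ a → mergeSides a (F (inj₂ s))) Fs)
      (trans (cong (mergeSides (F (inj₁ t))) Ft) (mergeSides-R⁺ _ (λ t∈L → ¬out∈L×in∈R t t∈L Ft)))
      (λ u v e u∈L v∈R →
         noEdge (inj₁ u) (inj₂ v) (inj₁ (arc u v e)) (mergeSides-L _ _ u∈L) (mergeSides-R _ _ v∈R))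

    lowerCut-weight : (w : Fin n → ℕ) →
                      weightS (allFin n) w (lowerCut F) + totalW w ≤ weightS (allV' n) (w' w) F
    lowerCut-weight w = begin
      weightS (allFin n) w (lowerCut F) + totalW w
        ≡⟨ weightS-+-total (allFin n) w (lowerCut F) ⟩
      sum (map (λ v → sw (lowerCut F v) (w v) + w v) (allFin n))
        ≤⟨ sum-map-mono-≤ (λ v → mergeSides-weight _ _ (w v) (out≢R v) (in≢L v) (¬out∈L×in∈R v)) (allFin n) ⟩
      sum (map (λ v → sw (F (inj₁ v)) (w v) + sw (F (inj₂ v)) (w v)) (allFin n))
        ≡⟨ sym (weightS-copies (allFin n) w F) ⟩
      weightS (allV' n) (w' w) F ∎
      where open ≤-Reasoning

  liftCut-minimiser : (w : Fin n → ℕ) {m : Fin n → Side} →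
                      IsMinimiser (IsSTCut (IsDirCut (Arc E)) s t) (weightS (allFin n) w) m →
                      IsMinimiser (IsSTCut (IsUndirCut (EdgeG' E)) (inj₁ s) (inj₂ t))
                                  (weightS (allV' n) (w' w)) (liftCut m)
  liftCut-minimiser w {m} (m-cut , m-min) = liftCut-isSTCut m-cut , λ F F-cut → begin
    weightS (allV' n) (w' w) (liftCut m)          ≡⟨ liftCut-weight (allFin n) w m ⟩
    weightS (allFin n) w m + totalW w             ≤⟨ +-monoˡ-≤ (totalW w) (m-min _ (lowerCut-isSTCut F-cut)) ⟩
    weightS (allFin n) w (lowerCut F) + totalW w  ≤⟨ lowerCut-weight F-cut w ⟩
    weightS (allV' n) (w' w) F                    ∎
    where open ≤-Reasoning

-- The positivity hypothesis is unused: the correspondence of cuts holds for arbitrary weights.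
lemma3p6 : (n : ℕ) (E : Fin n → Fin n → Bool) (w : Fin n → ℕ)
           → ((v : Fin n) → 0 < w v)
           → (s t : Fin n) → s ≢ t → ¬ (E s t ≡ true)
           → Σ ℕ λ k →
               IsKappa (IsDirCut (Arc E)) (allFin n) w s t k
               × IsKappa (IsUndirCut (EdgeG' E)) (allV' n) (w' w) (inj₁ s) (inj₂ t) (k + totalW w)
lemma3p6 n E w _ s t s≢t ¬st with m , m-min ← minimumSTCut E s t w (pointCut-isSTCut Fin._≟_ s≢t ¬st) =
  weightS (allFin n) w m ,
  minimiser⇒IsKappa (allFin n) w m-min refl ,
  minimiser⇒IsKappa (allV' n) (w' w) (liftCut-minimiser w m-min) (liftCut-weight (allFin n) w m)
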